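{- Let $n\ge 6$ and let $W_n$ be the wheel graph on vertex set $\{v_1,\ldots,v_n\}$, where $v_n$ is adjacent to all other vertices and $v_1,\ldots,v_{n-1}$ form the cycle $C_{n-1}$ ($v_i$ adjacent to $v_{i+1}$, indices of the cycle mod $n-1$). Then the center sets of $W_n$ are exactly: the singletons $\{v_i\}$, $1\le i\le n$; the sets $\{v_i,v_n\}$, $1\le i\le n-1$; the sets $\{v_i,v_j,v_n\}$ where $v_iv_j\in E(C_{n-1})$; and the sets $\{v_i,v_j,v_k,v_n\}$ where $v_iv_j,v_jv_k\in E(C_{n-1})$ with $v_i\neq v_k$.
   Context: $d$ is shortest-path distance. For nonempty $S\subseteq V$, $e_S(v)=\max_{x\in S}d(v,x)$ and $C_S(G)=\{v\in V: e_S(v)\le e_S(x)\ \forall x\in V\}$. A set $A\subseteq V$ is a center set of $G$ if $A=C_S(G)$ for some nonempty $S\subseteq V$. -}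

module Defs where

open import Data.Nat using (ℕ; zero; suc; _⊔_; _≤_; _∸_; _≡ᵇ_)
open import Data.Bool using (Bool; true; false; _∧_; _∨_; not; if_then_else_; T)
open import Data.Fin using (Fin; toℕ)
open import Data.Fin.Subset using (Subset; _∈_; Nonempty)
open import Data.List using (List; foldr; map)
open import Data.Bool.ListAction using (any)
open import Data.List using () renaming (allFin to allFinL)
open import Data.Vec using (lookup)
open import Data.Product using (Σ; ∃; _×_)
open import Data.Sum using (_⊎_)
open import Function.Bundles using (_⇔_)
open import Relation.Binary.PropositionalEquality using (_≡_; _≢_)

module Graph {n : ℕ} (Adj : Fin n → Fin n → Bool) where

  vertices : List (Fin n)
  vertices = allFinL n

  _==_ : Fin n → Fin n → Bool
  u == v = toℕ u ≡ᵇ toℕ v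

  Reach : ℕ → Fin n → Fin n → Bool
  Reach zero    u v = u == v
  Reach (suc k) u v = Reach k u v ∨ any (λ w → Reach k u w ∧ Adj w v) vertices

  search : ℕ → ℕ → Fin n → Fin n → ℕ
  search zero       k u v = k
  search (suc fuel) k u v = if Reach k u v then k else search fuel (suc k) u v

  -- shortest-path distance d(u,v) (for connected graphs: the least k
  -- such that a walk of length ≤ k from u to v exists; k ≤ n always)
  d : Fin n → Fin n → ℕ
  d u v = search n 0 u v

  ecc : Subset n → Fin n → ℕ
  ecc S v = foldr _⊔_ 0 (map (λ x → if lookup S x then d v x else 0) vertices)

  InCenter : Subset n → Fin n → Set
  InCenter S v = ∀ x → ecc S v ≤ ecc S x

  IsCenterSet : Subset n → Set
  IsCenterSet A = Σ (Subset n) λ S → Nonempty S × (∀ v → (v ∈ A) ⇔ InCenter S v)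

-- The wheel W_n on Fin n: vertex v_{i+1} is Fin-index i, so the hub v_n
-- has index n-1 and v_1..v_{n-1} (indices 0..n-2) form the cycle C_{n-1}.

module Wheel (n : ℕ) where

  isHub : Fin n → Bool
  isHub x = toℕ x ≡ᵇ (n ∸ 1)

  cycStep : Fin n → Fin n → Bool
  cycStep i j = (suc (toℕ i) ≡ᵇ toℕ j) ∨ ((toℕ i ≡ᵇ (n ∸ 2)) ∧ (toℕ j ≡ᵇ 0))

  cycAdj : Fin n → Fin n → Bool
  cycAdj i j = not (isHub i) ∧ not (isHub j) ∧ (cycStep i j ∨ cycStep j i)

  adj : Fin n → Fin n → Bool
  adj u v = (isHub u ∧ not (isHub v)) ∨ (isHub v ∧ not (isHub u)) ∨ cycAdj u v

  open Graph adj public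

  hub : Fin n → Set
  hub h = toℕ h ≡ n ∸ 1

  Listed : Subset n → Set
  Listed A =
      (∃ λ a → ∀ v → (v ∈ A) ⇔ (v ≡ a))
    ⊎ (∃ λ h → ∃ λ i → hub h × i ≢ h ×
         (∀ v → (v ∈ A) ⇔ (v ≡ i ⊎ v ≡ h)))
    ⊎ (∃ λ h → ∃ λ i → ∃ λ j → hub h × T (cycAdj i j) ×
         (∀ v → (v ∈ A) ⇔ (v ≡ i ⊎ v ≡ j ⊎ v ≡ h)))
    ⊎ (∃ λ h → ∃ λ i → ∃ λ j → ∃ λ k → hub h × T (cycAdj i j) × T (cycAdj j k) × i ≢ k ×
         (∀ v → (v ∈ A) ⇔ (v ≡ i ⊎ v ≡ j ⊎ v ≡ k ⊎ v ≡ h)))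

-- The hub of the wheel is adjacent to every other vertex, so every eccentricity is at most 1.
-- Hence C_S = S when S is a singleton, and otherwise C_S is the common closed neighbourhood
-- of S, which contains the hub.  If r ∈ S is a rim vertex this neighbourhood lies in
-- {r⁻, r, r⁺, hub}; since the rim has at least five vertices, the closed neighbourhoods of
-- r⁻ and r⁺ meet on the rim only in r, so r⁻ and r⁺ cannot both be central without r, and the
-- remaining seven possibilities are exactly the listed sets.  Conversely {v} = C_{v},
-- {vᵢ, hub} = C_{vᵢ₋₁, vᵢ₊₁}, {vᵢ, vⱼ, hub} = C_{vᵢ, vⱼ} (the rim has no triangles) and
-- {vᵢ, vⱼ, vₖ, hub} = C_{vⱼ, hub}.

module Submission where

open import Defs
open import Data.Bool using (Bool; true; false; T; _∧_; _∨_; if_then_else_)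
open import Data.Bool.Properties using (T-∨; T-∧; T-≡)
open import Data.Bool.ListAction using (any)
open import Data.Empty using (⊥; ⊥-elim)
open import Data.Fin using (Fin; toℕ; fromℕ; _≟_)
open import Data.Fin.Properties using (toℕ-injective; toℕ<n; toℕ-fromℕ; toℕ-fromℕ<; any?)
open import Data.Fin.Subset using (Subset; _∈_; ⁅_⁆; _∪_)
open import Data.Fin.Subset.Properties using (_∈?_; x∈⁅x⁆; x∈⁅y⁆⇒x≡y; x∈p∪q⁺; x∈p∪q⁻)
open import Data.List using ([]; _∷_; foldr; map)
open import Data.List.Membership.Propositional.Properties using (∈-allFin)
open import Data.List.Relation.Unary.Any as Any using (Any; here; there)
open import Data.List.Relation.Unary.Any.Properties using (any⁺; any⁻)
open import Data.Nat using (ℕ; zero; suc; _+_; _≤_; _<_; _≤′_; ≤′-refl; ≤′-step; _⊔_; _≡ᵇ_; _<?_; _≤?_; z≤n; s≤s)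
open import Data.Nat.DivMod using (_mod_; m<n⇒m%n≡m)
open import Data.Nat.GeneralisedArithmetic using (fold)
open import Data.Nat.Properties hiding (_≟_)
open import Data.Product using (_×_; _,_; proj₁; proj₂; ∃; ∃₂)
open import Data.Sum using (_⊎_; inj₁; inj₂; [_,_]; swap)
open import Data.Unit using (tt)
open import Data.Vec using (lookup)
open import Data.Vec.Properties using ([]=⇒lookup; lookup⇒[]=)
open import Function.Base using (_∘_)
open import Function.Bundles using (_⇔_; mk⇔; Equivalence)
open import Function.Construct.Composition using (_⇔-∘_)
open import Function.Construct.Symmetry using (⇔-sym)
open import Relation.Nullary using (¬_; yes; no; ¬?)
open import Relation.Nullary.Decidable using (True; toWitness; _×-dec_; decidable-stable)
open import Relation.Binary.PropositionalEquality hiding ([_])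

open Equivalence using (to; from)

-- Distances and centers in graphs with a universal vertex

≤foldr-⊔-map : ∀ {A : Set} (f : A → ℕ) {xs x} → Any (x ≡_) xs → f x ≤ foldr _⊔_ 0 (map f xs)
≤foldr-⊔-map f {y ∷ _} (here refl)  = m≤m⊔n (f y) _
≤foldr-⊔-map f {y ∷ _} (there x∈xs) = ≤-trans (≤foldr-⊔-map f x∈xs) (m≤n⊔m (f y) _)

foldr-⊔-map-lub : ∀ {A : Set} (f : A → ℕ) xs {b} → (∀ x → f x ≤ b) → foldr _⊔_ 0 (map f xs) ≤ b
foldr-⊔-map-lub f []       _   = z≤n
foldr-⊔-map-lub f (x ∷ xs) f≤b = ⊔-lub (f≤b x) (foldr-⊔-map-lub f xs f≤b)

module GraphProperties {n : ℕ} (Adj : Fin n → Fin n → Bool) where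
  open Graph Adj

  Near : Fin n → Fin n → Set
  Near u v = u ≡ v ⊎ T (Adj u v)

  NearAll : Subset n → Fin n → Set
  NearAll S v = ∀ x → x ∈ S → Near v x

  T-== : ∀ {u v} → T (u == v) ⇔ u ≡ v
  T-== {u} {v} = mk⇔ (toℕ-injective ∘ ≡ᵇ⇒≡ (toℕ u) (toℕ v)) (λ { refl → ≡⇒≡ᵇ (toℕ u) (toℕ u) refl })

  Reach-mono : ∀ {k l u v} → k ≤ l → T (Reach k u v) → T (Reach l u v)
  Reach-mono = mono′ ∘ ≤⇒≤′
    where
      mono′ : ∀ {k l u v} → k ≤′ l → T (Reach k u v) → T (Reach l u v)
      mono′ ≤′-refl        r = r
      mono′ (≤′-step k≤′l) r = from T-∨ (inj₁ (mono′ k≤′l r))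

  Reach₁⇔Near : ∀ {u v} → T (Reach 1 u v) ⇔ Near u v
  Reach₁⇔Near {u} {v} = mk⇔ reach⇒near (from T-∨ ∘ near⇒reach)
    where
      step : Fin n → Bool
      step w = (u == w) ∧ Adj w v

      reach⇒near : T (Reach 1 u v) → Near u v
      reach⇒near r with to T-∨ r
      ... | inj₁ u=v = inj₁ (to T-== u=v)
      ... | inj₂ viaW with Any.satisfied (any⁻ step vertices viaW)
      ...   | w , uw with to T-∧ uw
      ...     | u=w , adj = inj₂ (subst (λ x → T (Adj x v)) (sym (to T-== u=w)) adj)

      near⇒reach : Near u v → T (u == v) ⊎ T (any step vertices)
      near⇒reach (inj₁ refl) = inj₁ (from (T-== {u}) refl)
      near⇒reach (inj₂ adj)  = inj₂ (any⁺ step (Any.map (λ { refl → from T-∧ (from (T-== {u}) refl , adj) }) (∈-allFin u)))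

  search-≤ : ∀ fuel {j k u v} → j ≤ k → T (Reach k u v) → search fuel j u v ≤ k
  search-≤ zero       j≤k _ = j≤k
  search-≤ (suc fuel) {j} {k} {u} {v} j≤k r with Reach j u v in e
  ... | true  = j≤k
  ... | false = search-≤ fuel (≤∧≢⇒< j≤k λ { refl → subst T e r }) r

  search-reached : ∀ fuel j {u v} → T (Reach (search fuel j u v) u v) ⊎ search fuel j u v ≡ fuel + j
  search-reached zero       j = inj₂ refl
  search-reached (suc fuel) j {u} {v} with Reach j u v in e
  ... | true  = inj₁ (subst T (sym e) tt)
  ... | false = Data.Sum.map₂ (λ eq → trans eq (+-suc fuel j)) (search-reached fuel (suc j))

  -- d gives up after n steps, so a small bound on d yields a walk only when n exceeds it.
  d≤⇒Reach : ∀ {k u v} → d u v ≤ k → T (Reach k u v) ⊎ n ≤ k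
  d≤⇒Reach {k} {u} {v} d≤k with search-reached n 0 {u} {v}
  ... | inj₁ r  = inj₁ (Reach-mono d≤k r)
  ... | inj₂ eq = inj₂ (subst (_≤ k) (trans eq (+-identityʳ n)) d≤k)

  d≤0⇒≡ : ∀ {u v} → d u v ≤ 0 → u ≡ v
  d≤0⇒≡ {u} d≤0 with d≤⇒Reach d≤0
  ... | inj₁ r   = to T-== r
  ... | inj₂ n≤0 = ⊥-elim (n≮0 (<-≤-trans (toℕ<n u) n≤0))

  d≤1⇔Near : ∀ {u v} → d u v ≤ 1 ⇔ Near u v
  d≤1⇔Near {u} {v} = mk⇔ d≤1⇒near (search-≤ n z≤n ∘ from Reach₁⇔Near)
    where
      d≤1⇒near : d u v ≤ 1 → Near u v
      d≤1⇒near d≤1 with d≤⇒Reach d≤1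
      ... | inj₁ r   = to Reach₁⇔Near r
      ... | inj₂ n≤1 = inj₁ (toℕ-injective (trans (lone u) (sym (lone v))))
        where
          lone : ∀ w → toℕ w ≡ 0
          lone w = n<1⇒n≡0 (<-≤-trans (toℕ<n w) n≤1)

  ecc≤⇔ : ∀ {S v b} → ecc S v ≤ b ⇔ (∀ x → x ∈ S → d v x ≤ b)
  ecc≤⇔ {S} {v} {b} = mk⇔ ecc≤⇒ ⇒ecc≤
    where
      dist : Fin n → ℕ
      dist x = if lookup S x then d v x else 0

      ecc≤⇒ : ecc S v ≤ b → ∀ x → x ∈ S → d v x ≤ b
      ecc≤⇒ ecc≤b x x∈S = ≤-trans (≤-reflexive (cong (if_then d v x else 0) (sym ([]=⇒lookup x∈S))))
                             (≤-trans (≤foldr-⊔-map dist (∈-allFin x)) ecc≤b)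

      ⇒ecc≤ : (∀ x → x ∈ S → d v x ≤ b) → ecc S v ≤ b
      ⇒ecc≤ d≤b = foldr-⊔-map-lub dist vertices dist≤b
        where
          dist≤b : ∀ x → dist x ≤ b
          dist≤b x with lookup S x in x∈S
          ... | true  = d≤b x (lookup⇒[]= x S x∈S)
          ... | false = z≤n

  ecc≤1⇔NearAll : ∀ {S v} → ecc S v ≤ 1 ⇔ NearAll S v
  ecc≤1⇔NearAll = mk⇔ (λ ecc≤1 x x∈S → to d≤1⇔Near (to ecc≤⇔ ecc≤1 x x∈S))
                      (λ near → from ecc≤⇔ (λ x x∈S → from d≤1⇔Near (near x x∈S)))

  InCenter-singleton : ∀ {S s} → (∀ x → x ∈ S ⇔ x ≡ s) → ∀ v → InCenter S v ⇔ v ≡ s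
  InCenter-singleton {S} {s} S≡⁅s⁆ v =
    mk⇔ (λ central → d≤0⇒≡ (to ecc≤⇔ (≤-trans (central s) ecc[s]≤0) s (from (S≡⁅s⁆ s) refl)))
        (λ { refl x → ≤-trans ecc[s]≤0 z≤n })
    where
      ecc[s]≤0 : ecc S s ≤ 0
      ecc[s]≤0 = from ecc≤⇔ λ x x∈S → search-≤ n {k = 0} z≤n (from (T-== {s}) (sym (to (S≡⁅s⁆ x) x∈S)))

  isCenterSet-singleton : ∀ {A a} → (∀ v → v ∈ A ⇔ v ≡ a) → IsCenterSet A
  isCenterSet-singleton {A} {a} A≡⁅a⁆ =
    A , (a , from (A≡⁅a⁆ a) refl) , λ v → ⇔-sym (InCenter-singleton A≡⁅a⁆ v) ⇔-∘ A≡⁅a⁆ v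

  -- A universal vertex has eccentricity at most 1, and when |S| ≥ 2 no vertex has eccentricity 0.
  module UniversalVertex (h : Fin n) (universal : ∀ x → Near h x) where

    InCenter⇔NearAll : ∀ {S p q} → p ∈ S → q ∈ S → p ≢ q → ∀ v → InCenter S v ⇔ NearAll S v
    InCenter⇔NearAll {S} {p} {q} p∈S q∈S p≢q v =
      mk⇔ (λ central → to ecc≤1⇔NearAll (≤-trans (central h) (from (ecc≤1⇔NearAll {S}) (λ x _ → universal x))))
          (λ near x → ≤-trans (from ecc≤1⇔NearAll near) (n≢0⇒n>0 (ecc[x]≢0 x)))
      where
        ecc[x]≢0 : ∀ x → ecc S x ≢ 0
        ecc[x]≢0 x ecc≡0 = p≢q (trans (sym (on p∈S)) (on q∈S))
          where
            on : ∀ {y} → y ∈ S → x ≡ y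
            on y∈S = d≤0⇒≡ (to ecc≤⇔ (≤-reflexive ecc≡0) _ y∈S)

    InCenter-pair : ∀ {p q} → p ≢ q → ∀ v → InCenter (⁅ p ⁆ ∪ ⁅ q ⁆) v ⇔ (Near v p × Near v q)
    InCenter-pair {p} {q} p≢q v = mk⇔ (λ near → near p p∈ , near q q∈) near-both ⇔-∘ InCenter⇔NearAll p∈ q∈ p≢q v
      where
        p∈ = x∈p∪q⁺ (inj₁ (x∈⁅x⁆ p))
        q∈ = x∈p∪q⁺ {p = ⁅ p ⁆} (inj₂ (x∈⁅x⁆ q))
        near-both : Near v p × Near v q → NearAll (⁅ p ⁆ ∪ ⁅ q ⁆) v
        near-both (near-p , near-q) x x∈ with x∈p∪q⁻ ⁅ p ⁆ ⁅ q ⁆ x∈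
        ... | inj₁ x∈⁅p⁆ rewrite x∈⁅y⁆⇒x≡y p x∈⁅p⁆ = near-p
        ... | inj₂ x∈⁅q⁆ rewrite x∈⁅y⁆⇒x≡y q x∈⁅q⁆ = near-q

    isCenterSet-pair : ∀ {A p q} → p ≢ q → (∀ v → v ∈ A ⇔ (Near v p × Near v q)) → IsCenterSet A
    isCenterSet-pair {A} {p} {q} p≢q A≡N[p]∩N[q] =
      ⁅ p ⁆ ∪ ⁅ q ⁆ , (p , x∈p∪q⁺ (inj₁ (x∈⁅x⁆ p))) , λ v → ⇔-sym (InCenter-pair p≢q v) ⇔-∘ A≡N[p]∩N[q] v

    centerSet⇒singleton⊎NearAll : ∀ {A} → IsCenterSet A →
      (∃ λ a → ∀ v → v ∈ A ⇔ v ≡ a) ⊎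
      (∃ λ S → (∃₂ λ p q → p ∈ S × q ∈ S × p ≢ q) × (∀ v → v ∈ A ⇔ NearAll S v))
    centerSet⇒singleton⊎NearAll {A} (S , (s , s∈S) , A≡C) with any? (λ x → (x ∈? S) ×-dec ¬? (x ≟ s))
    ... | yes (q , q∈S , q≢s) = inj₂ (S , (q , s , q∈S , s∈S , q≢s) , λ v → InCenter⇔NearAll q∈S s∈S q≢s v ⇔-∘ A≡C v)
    ... | no  no-other        = inj₁ (s , λ v → InCenter-singleton S≡⁅s⁆ v ⇔-∘ A≡C v)
      where
        S≡⁅s⁆ : ∀ x → x ∈ S ⇔ x ≡ s
        S≡⁅s⁆ x = mk⇔ (λ x∈S → decidable-stable (x ≟ s) (λ x≢s → no-other (x , x∈S , x≢s))) (λ { refl → s∈S })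

-- Positions 0 … top on a cycle

module CyclicOrder (top : ℕ) where

  next : ℕ → ℕ
  next a = if a ≡ᵇ top then 0 else suc a

  prev : ℕ → ℕ
  prev zero    = top
  prev (suc a) = a

  step : ℕ → ℕ → Bool
  step a b = (suc a ≡ᵇ b) ∨ ((a ≡ᵇ top) ∧ (b ≡ᵇ 0))

  Adjacent : ℕ → ℕ → Set
  Adjacent a b = b ≡ next a ⊎ a ≡ next b

  Close : ℕ → ℕ → Set
  Close a b = a ≡ b ⊎ Adjacent a b

  _+ᶜ_ : ℕ → ℕ → ℕ
  a +ᶜ j = fold a next j

  next-≤ : ∀ {a} → a ≤ top → next a ≤ top
  next-≤ {a} a≤top with a ≡ᵇ top in a=top
  ... | true  = z≤n
  ... | false = ≤∧≢⇒< a≤top (subst T a=top ∘ ≡⇒≡ᵇ a top)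

  prev-≤ : ∀ {a} → a ≤ top → prev a ≤ top
  prev-≤ {zero}  _         = ≤-refl
  prev-≤ {suc a} a<top     = <⇒≤ a<top

  prev-next : ∀ a → prev (next a) ≡ a
  prev-next a with a ≡ᵇ top in a=top
  ... | true  = sym (≡ᵇ⇒≡ a top (from T-≡ a=top))
  ... | false = refl

  next-prev : ∀ {a} → a ≤ top → next (prev a) ≡ a
  next-prev {zero}  _ rewrite to T-≡ (≡⇒≡ᵇ top top refl) = refl
  next-prev {suc a} a<top with a ≡ᵇ top in a=top
  ... | true  = ⊥-elim (<-irrefl (≡ᵇ⇒≡ a top (from T-≡ a=top)) a<top)
  ... | false = refl

  T-step⇔ : ∀ {a b} → a ≤ top → b ≤ top → T (step a b) ⇔ b ≡ next a
  T-step⇔ {a} {b} a≤top b≤top with a ≡ᵇ top in a=top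
  ... | true  = mk⇔ (λ s → [ wraps-past-top , ≡ᵇ⇒≡ b 0 ] (to T-∨ s)) (λ { refl → tt })
    where
      wraps-past-top : T (suc a ≡ᵇ b) → b ≡ 0
      wraps-past-top s =
        ⊥-elim (1+n≰n (subst (_≤ top) (trans (sym (≡ᵇ⇒≡ (suc a) b s)) (cong suc (≡ᵇ⇒≡ a top (from T-≡ a=top)))) b≤top))
  ... | false = mk⇔ (λ s → [ sym ∘ ≡ᵇ⇒≡ (suc a) b , (λ ()) ] (to T-∨ s))
                    (λ { refl → from T-∨ (inj₁ (≡⇒≡ᵇ (suc a) (suc a) refl)) })

  Adjacent-sym : ∀ {a b} → Adjacent a b → Adjacent b a
  Adjacent-sym = swap

  Adjacent⇒next⊎prev : ∀ {a b} → Adjacent a b → b ≡ next a ⊎ b ≡ prev a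
  Adjacent⇒next⊎prev (inj₁ b≡next) = inj₁ b≡next
  Adjacent⇒next⊎prev (inj₂ refl)   = inj₂ (sym (prev-next _))

  Close⇒prev⊎≡⊎next : ∀ {x a} → Close x a → x ≡ prev a ⊎ x ≡ a ⊎ x ≡ next a
  Close⇒prev⊎≡⊎next (inj₁ x≡a) = inj₂ (inj₁ x≡a)
  Close⇒prev⊎≡⊎next (inj₂ x~a) with Adjacent⇒next⊎prev (Adjacent-sym x~a)
  ... | inj₁ x≡next = inj₂ (inj₂ x≡next)
  ... | inj₂ x≡prev = inj₁ x≡prev

  Close-middle : ∀ {a b c x} → Adjacent a b → Adjacent b c → a ≢ c → Close x b → x ≡ a ⊎ x ≡ b ⊎ x ≡ c
  Close-middle {a} {b} {c} {x} a~b b~c a≢c x≈b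
    with Adjacent⇒next⊎prev (Adjacent-sym a~b) | Adjacent⇒next⊎prev b~c | Close⇒prev⊎≡⊎next x≈b
  ... | _          | _          | inj₂ (inj₁ x≡b) = inj₂ (inj₁ x≡b)
  ... | inj₁ refl  | inj₁ refl  | _               = ⊥-elim (a≢c refl)
  ... | inj₂ refl  | inj₂ refl  | _               = ⊥-elim (a≢c refl)
  ... | inj₁ refl  | inj₂ refl  | inj₁ x≡prev     = inj₂ (inj₂ x≡prev)
  ... | inj₁ refl  | inj₂ refl  | inj₂ (inj₂ x≡next) = inj₁ x≡next
  ... | inj₂ refl  | inj₁ refl  | inj₁ x≡prev     = inj₁ x≡prev
  ... | inj₂ refl  | inj₁ refl  | inj₂ (inj₂ x≡next) = inj₂ (inj₂ x≡next)

  +ᶜ-wraps : ∀ {a} j → a ≤ top → j ≤ top → a +ᶜ j ≡ a + j ⊎ a +ᶜ j + suc top ≡ a + j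
  +ᶜ-wraps {a} zero    _     _     = inj₁ (sym (+-identityʳ a))
  +ᶜ-wraps {a} (suc j) a≤top j<top with a +ᶜ j ≡ᵇ top in at-top | +ᶜ-wraps j a≤top (<⇒≤ j<top)
  ... | true  | inj₁ eq = inj₂ (trans (cong suc (trans (sym (≡ᵇ⇒≡ _ top (from T-≡ at-top))) eq)) (sym (+-suc a j)))
  ... | true  | inj₂ eq = ⊥-elim (<-irrefl (trans (sym eq) (cong (_+ suc top) (≡ᵇ⇒≡ _ top (from T-≡ at-top))))
                                            (+-mono-≤-< a≤top (≤-trans j<top (n≤1+n top))))
  ... | false | inj₁ eq = inj₁ (trans (cong suc eq) (sym (+-suc a j)))
  ... | false | inj₂ eq = inj₂ (trans (cong suc eq) (sym (+-suc a j)))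

  no-full-turn : ∀ a {i j} → a + i + suc top ≡ a + j → j ≤ top → ⊥
  no-full-turn a {i} eq j≤top with +-cancelˡ-≡ a _ _ (trans (sym (+-assoc a i _)) eq)
  ... | refl = 1+n≰n (m+n≤o⇒n≤o i j≤top)

  +ᶜ-injective : ∀ {a i j} → a ≤ top → i < j → j ≤ top → a +ᶜ i ≢ a +ᶜ j
  +ᶜ-injective {a} {i} {j} a≤top i<j j≤top same
    with +ᶜ-wraps i a≤top (≤-trans (<⇒≤ i<j) j≤top) | +ᶜ-wraps j a≤top j≤top
  ... | inj₁ ei | inj₁ ej = <⇒≢ i<j (+-cancelˡ-≡ a i j (trans (sym ei) (trans same ej)))
  ... | inj₂ ei | inj₂ ej = <⇒≢ i<j (+-cancelˡ-≡ a i j (trans (sym ei) (trans (cong (_+ suc top) same) ej)))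
  ... | inj₁ ei | inj₂ ej = no-full-turn a (trans (cong (_+ suc top) (trans (sym ei) same)) ej) j≤top
  ... | inj₂ ei | inj₁ ej = no-full-turn a (trans (cong (_+ suc top) (trans (sym ej) (sym same))) ei) (≤-trans (<⇒≤ i<j) j≤top)

  Adjacent-next : ∀ a → Adjacent a (next a)
  Adjacent-next a = inj₁ refl

  Adjacent-prev : ∀ {a} → a ≤ top → Adjacent (prev a) a
  Adjacent-prev a≤top = inj₁ (sym (next-prev a≤top))

  -- On a cycle with at least five positions, the five positions around a are pairwise distinct.
  module _ (4≤top : 4 ≤ top) where

    module _ {a} (a≤top : a ≤ top) where
      private
        base : ℕ
        base = prev (prev a)

        at₁ : prev a ≡ base +ᶜ 1
        at₁ = sym (next-prev (prev-≤ a≤top))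

        at₂ : a ≡ base +ᶜ 2
        at₂ = trans (sym (next-prev a≤top)) (cong next at₁)

        at₃ : next a ≡ base +ᶜ 3
        at₃ = cong next at₂

        at₄ : next (next a) ≡ base +ᶜ 4
        at₄ = cong next at₃

        apart : ∀ {x y} i j {i<j : True (i <? j)} {j≤4 : True (j ≤? 4)} → x ≡ base +ᶜ i → y ≡ base +ᶜ j → x ≢ y
        apart i j {i<j} {j≤4} refl refl =
          +ᶜ-injective (prev-≤ (prev-≤ a≤top)) (toWitness i<j) (≤-trans (toWitness j≤4) 4≤top)

      next≢self : next a ≢ a
      next≢self = ≢-sym (apart 2 3 at₂ at₃)

      prev≢next : prev a ≢ next a
      prev≢next = apart 1 3 at₁ at₃

      Adjacent-irrefl : ¬ Adjacent a a
      Adjacent-irrefl (inj₁ a≡next) = next≢self (sym a≡next)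
      Adjacent-irrefl (inj₂ a≡next) = next≢self (sym a≡next)

      Close-next : ∀ {x} → Close x a → Close x (next a) → x ≡ a ⊎ x ≡ next a
      Close-next x≈a x≈next with Close⇒prev⊎≡⊎next x≈a | Close⇒prev⊎≡⊎next x≈next
      ... | inj₂ (inj₁ x≡a)    | _                   = inj₁ x≡a
      ... | inj₂ (inj₂ x≡next) | _                   = inj₂ x≡next
      ... | inj₁ _             | inj₁ x≡prev-next    = inj₁ (trans x≡prev-next (prev-next a))
      ... | inj₁ _             | inj₂ (inj₁ x≡next)  = inj₂ x≡next
      ... | inj₁ x≡prev        | inj₂ (inj₂ x≡next²) = ⊥-elim (apart 1 4 (trans x≡prev at₁) (trans x≡next² at₄) refl)

      Close-prev-next : ∀ {x} → Close x (prev a) → Close x (next a) → x ≡ a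
      Close-prev-next x≈prev x≈next with Close⇒prev⊎≡⊎next x≈prev | Close⇒prev⊎≡⊎next x≈next
      ... | inj₂ (inj₂ x≡next-prev) | _                   = trans x≡next-prev (next-prev a≤top)
      ... | _                       | inj₁ x≡prev-next    = trans x≡prev-next (prev-next a)
      ... | inj₁ x≡prev²            | inj₂ (inj₁ x≡next)  = ⊥-elim (apart 0 3 x≡prev² (trans x≡next at₃) refl)
      ... | inj₁ x≡prev²            | inj₂ (inj₂ x≡next²) = ⊥-elim (apart 0 4 x≡prev² (trans x≡next² at₄) refl)
      ... | inj₂ (inj₁ x≡prev)      | inj₂ (inj₁ x≡next)  = ⊥-elim (apart 1 3 (trans x≡prev at₁) (trans x≡next at₃) refl)
      ... | inj₂ (inj₁ x≡prev)      | inj₂ (inj₂ x≡next²) = ⊥-elim (apart 1 4 (trans x≡prev at₁) (trans x≡next² at₄) refl)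

    Close-edge : ∀ {a b x} → a ≤ top → b ≤ top → Adjacent a b → Close x a → Close x b → x ≡ a ⊎ x ≡ b
    Close-edge a≤top _     (inj₁ refl) x≈a x≈b = Close-next a≤top x≈a x≈b
    Close-edge _     b≤top (inj₂ refl) x≈a x≈b = swap (Close-next b≤top x≈b x≈a)

-- Vertex vᵢ₊₁ has index i: the hub is H = 5 + k, and the rim positions 0 … 4 + k form the
-- cycle of CyclicOrder (4 + k), whose step is Defs' cycStep read through toℕ.
module WheelCenters (k : ℕ) where
  open Wheel (6 + k)
  open GraphProperties adj
  open CyclicOrder (4 + k)

  H : Fin (6 + k)
  H = fromℕ (5 + k)

  hub-H : hub H
  hub-H = toℕ-fromℕ (5 + k)

  4≤top : 4 ≤ 4 + k
  4≤top = m≤m+n 4 k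

  hub⇒≡H : ∀ {h} → hub h → h ≡ H
  hub⇒≡H h-hub = toℕ-injective (trans h-hub (sym (toℕ-fromℕ (5 + k))))

  isHub-H : isHub H ≡ true
  isHub-H = to T-≡ (≡⇒≡ᵇ (toℕ H) (5 + k) (toℕ-fromℕ (5 + k)))

  position-≤ : ∀ {v} → v ≢ H → toℕ v ≤ 4 + k
  position-≤ {v} v≢H = ≤-pred (≤∧≢⇒< (≤-pred (toℕ<n v)) (v≢H ∘ hub⇒≡H))

  ≢H⇒isHub≡false : ∀ {v} → v ≢ H → isHub v ≡ false
  ≢H⇒isHub≡false {v} v≢H with isHub v in v-hub
  ... | true  = ⊥-elim (v≢H (hub⇒≡H (≡ᵇ⇒≡ (toℕ v) (5 + k) (from T-≡ v-hub))))
  ... | false = refl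

  isHub≡false⇒≢H : ∀ {v} → isHub v ≡ false → v ≢ H
  isHub≡false⇒≢H v-rim refl with () ← trans (sym isHub-H) v-rim

  adj-H : ∀ {v} → v ≢ H → T (adj H v)
  adj-H v≢H rewrite isHub-H | ≢H⇒isHub≡false v≢H = tt

  adj-toH : ∀ {v} → v ≢ H → T (adj v H)
  adj-toH v≢H rewrite isHub-H | ≢H⇒isHub≡false v≢H = tt

  rim-step⇔ : ∀ {u v} → u ≢ H → v ≢ H → T (cycStep u v ∨ cycStep v u) ⇔ Adjacent (toℕ u) (toℕ v)
  rim-step⇔ u≢H v≢H =
    mk⇔ (Data.Sum.map (to (T-step⇔ u≤ v≤)) (to (T-step⇔ v≤ u≤)) ∘ to T-∨)
        (from T-∨ ∘ Data.Sum.map (from (T-step⇔ u≤ v≤)) (from (T-step⇔ v≤ u≤)))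
    where
      u≤ = position-≤ u≢H
      v≤ = position-≤ v≢H

  adj-rim⇔ : ∀ {u v} → u ≢ H → v ≢ H → T (adj u v) ⇔ Adjacent (toℕ u) (toℕ v)
  adj-rim⇔ u≢H v≢H rewrite ≢H⇒isHub≡false u≢H | ≢H⇒isHub≡false v≢H = rim-step⇔ u≢H v≢H

  cycAdj⇔ : ∀ {u v} → T (cycAdj u v) ⇔ (u ≢ H × v ≢ H × Adjacent (toℕ u) (toℕ v))
  cycAdj⇔ {u} {v} = mk⇔ cycAdj⇒ ⇒cycAdj
    where
      cycAdj⇒ : T (cycAdj u v) → u ≢ H × v ≢ H × Adjacent (toℕ u) (toℕ v)
      cycAdj⇒ c with isHub u in u-rim | isHub v in v-rim
      ... | false | false = u≢H , v≢H , to (rim-step⇔ u≢H v≢H) c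
        where
          u≢H = isHub≡false⇒≢H u-rim
          v≢H = isHub≡false⇒≢H v-rim

      ⇒cycAdj : u ≢ H × v ≢ H × Adjacent (toℕ u) (toℕ v) → T (cycAdj u v)
      ⇒cycAdj (u≢H , v≢H , u~v) rewrite ≢H⇒isHub≡false u≢H | ≢H⇒isHub≡false v≢H = from (rim-step⇔ u≢H v≢H) u~v

  hub-near : ∀ v → Near H v
  hub-near v with v ≟ H
  ... | yes refl = inj₁ refl
  ... | no  v≢H  = inj₂ (adj-H v≢H)

  near-hub : ∀ v → Near v H
  near-hub v with v ≟ H
  ... | yes refl = inj₁ refl
  ... | no  v≢H  = inj₂ (adj-toH v≢H)

  Near-sym : ∀ {u v} → Near u v → Near v u
  Near-sym (inj₁ refl) = inj₁ refl
  Near-sym {u} {v} (inj₂ u~v) with u ≟ H | v ≟ H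
  ... | yes refl | yes refl = inj₁ refl
  ... | yes refl | no v≢H   = near-hub v
  ... | no u≢H   | yes refl = hub-near u
  ... | no u≢H   | no v≢H   = inj₂ (from (adj-rim⇔ v≢H u≢H) (Adjacent-sym (to (adj-rim⇔ u≢H v≢H) u~v)))

  Near-rim⇔ : ∀ {u v} → u ≢ H → v ≢ H → Near u v ⇔ Close (toℕ u) (toℕ v)
  Near-rim⇔ u≢H v≢H = mk⇔ (Data.Sum.map (cong toℕ) (to (adj-rim⇔ u≢H v≢H)))
                          (Data.Sum.map toℕ-injective (from (adj-rim⇔ u≢H v≢H)))

  vertex : ℕ → Fin (6 + k)
  vertex a = a mod (6 + k)

  module _ {a} (a≤top : a ≤ 4 + k) where
    toℕ-vertex : toℕ (vertex a) ≡ a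
    toℕ-vertex = trans (toℕ-fromℕ< _) (m<n⇒m%n≡m (s≤s (≤-trans a≤top (n≤1+n _))))

    vertex-rim : vertex a ≢ H
    vertex-rim vertex≡H =
      1+n≰n (subst (_≤ 4 + k) (trans (sym toℕ-vertex) (trans (cong toℕ vertex≡H) (toℕ-fromℕ (5 + k)))) a≤top)

  succ pred : Fin (6 + k) → Fin (6 + k)
  succ v = vertex (next (toℕ v))
  pred v = vertex (prev (toℕ v))

  open UniversalVertex H hub-near

  cycAdj-sym : ∀ {u v} → T (cycAdj u v) → T (cycAdj v u)
  cycAdj-sym {u} {v} u~v with to (cycAdj⇔ {u} {v}) u~v
  ... | u≢H , v≢H , adjacent = from (cycAdj⇔ {v} {u}) (v≢H , u≢H , Adjacent-sym adjacent)

  cycAdj⇒Near : ∀ {u v} → T (cycAdj u v) → Near u v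
  cycAdj⇒Near {u} {v} u~v with to (cycAdj⇔ {u} {v}) u~v
  ... | u≢H , v≢H , adjacent = inj₂ (from (adj-rim⇔ u≢H v≢H) adjacent)

  module _ {r} (r≢H : r ≢ H) where
    private
      r≤top = position-≤ r≢H

    toℕ-succ : toℕ (succ r) ≡ next (toℕ r)
    toℕ-succ = toℕ-vertex (next-≤ r≤top)

    toℕ-pred : toℕ (pred r) ≡ prev (toℕ r)
    toℕ-pred = toℕ-vertex (prev-≤ r≤top)

    succ-rim : succ r ≢ H
    succ-rim = vertex-rim (next-≤ r≤top)

    pred-rim : pred r ≢ H
    pred-rim = vertex-rim (prev-≤ r≤top)

    pred≢succ : pred r ≢ succ r
    pred≢succ pred≡succ = prev≢next 4≤top r≤top (trans (sym toℕ-pred) (trans (cong toℕ pred≡succ) toℕ-succ))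

    cycAdj-pred : T (cycAdj (pred r) r)
    cycAdj-pred = from cycAdj⇔ (pred-rim , r≢H , subst (λ p → Adjacent p (toℕ r)) (sym toℕ-pred) (Adjacent-prev r≤top))

    cycAdj-succ : T (cycAdj r (succ r))
    cycAdj-succ = from cycAdj⇔ (r≢H , succ-rim , subst (Adjacent (toℕ r)) (sym toℕ-succ) (Adjacent-next (toℕ r)))

    Near⇒pred⊎≡⊎succ⊎H : ∀ {v} → Near v r → v ≡ pred r ⊎ v ≡ r ⊎ v ≡ succ r ⊎ v ≡ H
    Near⇒pred⊎≡⊎succ⊎H {v} v≈r with v ≟ H
    ... | yes v≡H = inj₂ (inj₂ (inj₂ v≡H))
    ... | no  v≢H with Close⇒prev⊎≡⊎next (to (Near-rim⇔ v≢H r≢H) v≈r)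
    ...   | inj₁ v≡prev        = inj₁ (toℕ-injective (trans v≡prev (sym toℕ-pred)))
    ...   | inj₂ (inj₁ v≡r)    = inj₂ (inj₁ (toℕ-injective v≡r))
    ...   | inj₂ (inj₂ v≡next) = inj₂ (inj₂ (inj₁ (toℕ-injective (trans v≡next (sym toℕ-succ)))))

    Near-pred-succ⇔ : ∀ {v} → (Near v (pred r) × Near v (succ r)) ⇔ (v ≡ r ⊎ v ≡ H)
    Near-pred-succ⇔ {v} = mk⇔ ⇒r⊎H r⊎H⇒
      where
        ⇒r⊎H : Near v (pred r) × Near v (succ r) → v ≡ r ⊎ v ≡ H
        ⇒r⊎H (v≈pred , v≈succ) with v ≟ H
        ... | yes v≡H = inj₂ v≡H
        ... | no  v≢H = inj₁ (toℕ-injective (Close-prev-next 4≤top r≤top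
                (subst (Close (toℕ v)) toℕ-pred (to (Near-rim⇔ v≢H pred-rim) v≈pred))
                (subst (Close (toℕ v)) toℕ-succ (to (Near-rim⇔ v≢H succ-rim) v≈succ))))

        r⊎H⇒ : v ≡ r ⊎ v ≡ H → Near v (pred r) × Near v (succ r)
        r⊎H⇒ (inj₁ refl) = cycAdj⇒Near (cycAdj-sym {pred r} {r} cycAdj-pred) , cycAdj⇒Near {r} cycAdj-succ
        r⊎H⇒ (inj₂ refl) = hub-near (pred r) , hub-near (succ r)

  cycAdj-≢ : ∀ {u v} → T (cycAdj u v) → u ≢ v
  cycAdj-≢ {u} {v} u~v refl with to (cycAdj⇔ {u} {u}) u~v
  ... | u≢H , _ , adjacent = Adjacent-irrefl 4≤top (position-≤ u≢H) adjacent

  Near-edge⇔ : ∀ {i j v} → T (cycAdj i j) → (Near v i × Near v j) ⇔ (v ≡ i ⊎ v ≡ j ⊎ v ≡ H)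
  Near-edge⇔ {i} {j} {v} i~j = mk⇔ ⇒i⊎j⊎H i⊎j⊎H⇒
    where
      ⇒i⊎j⊎H : Near v i × Near v j → v ≡ i ⊎ v ≡ j ⊎ v ≡ H
      ⇒i⊎j⊎H (v≈i , v≈j) with v ≟ H | to (cycAdj⇔ {i} {j}) i~j
      ... | yes v≡H | _ = inj₂ (inj₂ v≡H)
      ... | no  v≢H | i≢H , j≢H , adjacent =
        Data.Sum.map toℕ-injective (inj₁ ∘ toℕ-injective)
          (Close-edge 4≤top (position-≤ i≢H) (position-≤ j≢H) adjacent
            (to (Near-rim⇔ v≢H i≢H) v≈i) (to (Near-rim⇔ v≢H j≢H) v≈j))

      i⊎j⊎H⇒ : v ≡ i ⊎ v ≡ j ⊎ v ≡ H → Near v i × Near v j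
      i⊎j⊎H⇒ (inj₁ refl)         = inj₁ refl , cycAdj⇒Near {i} i~j
      i⊎j⊎H⇒ (inj₂ (inj₁ refl))  = cycAdj⇒Near (cycAdj-sym {i} {j} i~j) , inj₁ refl
      i⊎j⊎H⇒ (inj₂ (inj₂ refl))  = hub-near i , hub-near j

  Near-middle⇔ : ∀ {i j l v} → T (cycAdj i j) → T (cycAdj j l) → i ≢ l →
                 (Near v j × Near v H) ⇔ (v ≡ i ⊎ v ≡ j ⊎ v ≡ l ⊎ v ≡ H)
  Near-middle⇔ {i} {j} {l} {v} i~j j~l i≢l = mk⇔ ⇒i⊎j⊎l⊎H i⊎j⊎l⊎H⇒
    where
      ⇒i⊎j⊎l⊎H : Near v j × Near v H → v ≡ i ⊎ v ≡ j ⊎ v ≡ l ⊎ v ≡ H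
      ⇒i⊎j⊎l⊎H (v≈j , _) with v ≟ H | to (cycAdj⇔ {i} {j}) i~j | to (cycAdj⇔ {j} {l}) j~l
      ... | yes v≡H | _ | _ = inj₂ (inj₂ (inj₂ v≡H))
      ... | no  v≢H | _ , j≢H , i-j | _ , _ , j-l =
        Data.Sum.map toℕ-injective (Data.Sum.map toℕ-injective (inj₁ ∘ toℕ-injective))
          (Close-middle i-j j-l (i≢l ∘ toℕ-injective) (to (Near-rim⇔ v≢H j≢H) v≈j))

      i⊎j⊎l⊎H⇒ : v ≡ i ⊎ v ≡ j ⊎ v ≡ l ⊎ v ≡ H → Near v j × Near v H
      i⊎j⊎l⊎H⇒ (inj₁ refl)                = cycAdj⇒Near {i} i~j , near-hub i
      i⊎j⊎l⊎H⇒ (inj₂ (inj₁ refl))         = inj₁ refl , near-hub j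
      i⊎j⊎l⊎H⇒ (inj₂ (inj₂ (inj₁ refl)))  = cycAdj⇒Near (cycAdj-sym {j} {l} j~l) , near-hub l
      i⊎j⊎l⊎H⇒ (inj₂ (inj₂ (inj₂ refl)))  = hub-near j , inj₁ refl

  isCenterSet-rim-hub : ∀ {A i h} → h ≡ H → i ≢ h → (∀ v → v ∈ A ⇔ (v ≡ i ⊎ v ≡ h)) → IsCenterSet A
  isCenterSet-rim-hub refl i≢H A≡ = isCenterSet-pair (pred≢succ i≢H) (λ v → ⇔-sym (Near-pred-succ⇔ i≢H) ⇔-∘ A≡ v)

  isCenterSet-edge-hub : ∀ {A i j h} → h ≡ H → T (cycAdj i j) →
                         (∀ v → v ∈ A ⇔ (v ≡ i ⊎ v ≡ j ⊎ v ≡ h)) → IsCenterSet A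
  isCenterSet-edge-hub {i = i} {j} refl i~j A≡ = isCenterSet-pair (cycAdj-≢ {i} {j} i~j) (λ v → ⇔-sym (Near-edge⇔ i~j) ⇔-∘ A≡ v)

  isCenterSet-path-hub : ∀ {A i j l h} → h ≡ H → T (cycAdj i j) → T (cycAdj j l) → i ≢ l →
                         (∀ v → v ∈ A ⇔ (v ≡ i ⊎ v ≡ j ⊎ v ≡ l ⊎ v ≡ h)) → IsCenterSet A
  isCenterSet-path-hub {i = i} {j} refl i~j j~l i≢l A≡ =
    isCenterSet-pair (proj₁ (proj₂ (to (cycAdj⇔ {i} {j}) i~j))) (λ v → ⇔-sym (Near-middle⇔ i~j j~l i≢l) ⇔-∘ A≡ v)

  listed⇒centerSet : ∀ {A} → Listed A → IsCenterSet A
  listed⇒centerSet (inj₁ (_ , A≡⁅a⁆))                                         = isCenterSet-singleton A≡⁅a⁆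
  listed⇒centerSet (inj₂ (inj₁ (_ , _ , h-hub , i≢h , A≡)))                     = isCenterSet-rim-hub (hub⇒≡H h-hub) i≢h A≡
  listed⇒centerSet (inj₂ (inj₂ (inj₁ (_ , _ , _ , h-hub , i~j , A≡))))          = isCenterSet-edge-hub (hub⇒≡H h-hub) i~j A≡
  listed⇒centerSet (inj₂ (inj₂ (inj₂ (_ , _ , _ , _ , h-hub , i~j , j~l , i≢l , A≡)))) =
    isCenterSet-path-hub (hub⇒≡H h-hub) i~j j~l i≢l A≡

  module _ {A r} (r≢H : r ≢ H) (H∈A : H ∈ A)
           (A⊆window : ∀ v → v ∈ A → v ≡ pred r ⊎ v ≡ r ⊎ v ≡ succ r ⊎ v ≡ H)
           (convex : pred r ∈ A → succ r ∈ A → r ∈ A) where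
    private
      exactly : ∀ {Q : Fin (6 + k) → Set} → (∀ v → Q v → v ∈ A) → Q H →
                (pred r ∈ A → Q (pred r)) → (r ∈ A → Q r) → (succ r ∈ A → Q (succ r)) →
                ∀ v → v ∈ A ⇔ Q v
      exactly {Q} Q⊆A Q-H Q-pred Q-r Q-succ v = mk⇔ A⊆Q (Q⊆A v)
        where
          A⊆Q : v ∈ A → Q v
          A⊆Q v∈A with A⊆window v v∈A
          ... | inj₁ refl                = Q-pred v∈A
          ... | inj₂ (inj₁ refl)         = Q-r v∈A
          ... | inj₂ (inj₂ (inj₁ refl))  = Q-succ v∈A
          ... | inj₂ (inj₂ (inj₂ refl))  = Q-H

    window⇒listed : Listed A
    window⇒listed with pred r ∈? A | r ∈? A | succ r ∈? A
    ... | no p∉ | no r∉ | no s∉ =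
      inj₁ (H , exactly (λ { _ refl → H∈A }) refl (⊥-elim ∘ p∉) (⊥-elim ∘ r∉) (⊥-elim ∘ s∉))
    ... | yes p∈ | no r∉ | no s∉ =
      inj₂ (inj₁ (H , pred r , hub-H , pred-rim r≢H ,
        exactly (λ { _ (inj₁ refl) → p∈ ; _ (inj₂ refl) → H∈A })
                (inj₂ refl) (λ _ → inj₁ refl) (⊥-elim ∘ r∉) (⊥-elim ∘ s∉)))
    ... | no p∉ | yes r∈ | no s∉ =
      inj₂ (inj₁ (H , r , hub-H , r≢H ,
        exactly (λ { _ (inj₁ refl) → r∈ ; _ (inj₂ refl) → H∈A })
                (inj₂ refl) (⊥-elim ∘ p∉) (λ _ → inj₁ refl) (⊥-elim ∘ s∉)))
    ... | no p∉ | no r∉ | yes s∈ =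
      inj₂ (inj₁ (H , succ r , hub-H , succ-rim r≢H ,
        exactly (λ { _ (inj₁ refl) → s∈ ; _ (inj₂ refl) → H∈A })
                (inj₂ refl) (⊥-elim ∘ p∉) (⊥-elim ∘ r∉) (λ _ → inj₁ refl)))
    ... | yes p∈ | no r∉ | yes s∈ = ⊥-elim (r∉ (convex p∈ s∈))
    ... | yes p∈ | yes r∈ | no s∉ =
      inj₂ (inj₂ (inj₁ (H , pred r , r , hub-H , cycAdj-pred r≢H ,
        exactly (λ { _ (inj₁ refl) → p∈ ; _ (inj₂ (inj₁ refl)) → r∈ ; _ (inj₂ (inj₂ refl)) → H∈A })
                (inj₂ (inj₂ refl)) (λ _ → inj₁ refl) (λ _ → inj₂ (inj₁ refl)) (⊥-elim ∘ s∉))))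
    ... | no p∉ | yes r∈ | yes s∈ =
      inj₂ (inj₂ (inj₁ (H , r , succ r , hub-H , cycAdj-succ r≢H ,
        exactly (λ { _ (inj₁ refl) → r∈ ; _ (inj₂ (inj₁ refl)) → s∈ ; _ (inj₂ (inj₂ refl)) → H∈A })
                (inj₂ (inj₂ refl)) (⊥-elim ∘ p∉) (λ _ → inj₁ refl) (λ _ → inj₂ (inj₁ refl)))))
    ... | yes p∈ | yes r∈ | yes s∈ =
      inj₂ (inj₂ (inj₂ (H , pred r , r , succ r , hub-H , cycAdj-pred r≢H , cycAdj-succ r≢H , pred≢succ r≢H ,
        exactly (λ { _ (inj₁ refl) → p∈ ; _ (inj₂ (inj₁ refl)) → r∈
                   ; _ (inj₂ (inj₂ (inj₁ refl))) → s∈ ; _ (inj₂ (inj₂ (inj₂ refl))) → H∈A })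
                (inj₂ (inj₂ (inj₂ refl)))
                (λ _ → inj₁ refl) (λ _ → inj₂ (inj₁ refl)) (λ _ → inj₂ (inj₂ (inj₁ refl))))))

  NearAll⇒listed : ∀ {A S r} → r ∈ S → r ≢ H → (∀ v → v ∈ A ⇔ NearAll S v) → Listed A
  NearAll⇒listed {A} {S} {r} r∈S r≢H A≡ = window⇒listed r≢H H∈A A⊆window convex
    where
      H∈A : H ∈ A
      H∈A = from (A≡ H) (λ x _ → hub-near x)

      A⊆window : ∀ v → v ∈ A → v ≡ pred r ⊎ v ≡ r ⊎ v ≡ succ r ⊎ v ≡ H
      A⊆window v v∈A = Near⇒pred⊎≡⊎succ⊎H r≢H (to (A≡ v) v∈A r r∈S)

      convex : pred r ∈ A → succ r ∈ A → r ∈ A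
      convex p∈ s∈ = from (A≡ r) λ x x∈S →
        [ (λ { refl → inj₁ refl }) , (λ { refl → near-hub r }) ]
          (to (Near-pred-succ⇔ r≢H) (Near-sym (to (A≡ _) p∈ x x∈S) , Near-sym (to (A≡ _) s∈ x x∈S)))

  rim-member : ∀ {S : Subset (6 + k)} {p q} → p ∈ S → q ∈ S → p ≢ q → ∃ λ r → r ∈ S × r ≢ H
  rim-member {p = p} p∈S q∈S p≢q with p ≟ H
  ... | no  p≢H = p , p∈S , p≢H
  ... | yes p≡H = _ , q∈S , λ q≡H → p≢q (trans p≡H (sym q≡H))

  centerSet⇒listed : ∀ {A} → IsCenterSet A → Listed A
  centerSet⇒listed cs with centerSet⇒singleton⊎NearAll cs
  ... | inj₁ singleton = inj₁ singleton
  ... | inj₂ (S , (p , q , p∈S , q∈S , p≢q) , A≡) =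
    let r , r∈S , r≢H = rim-member p∈S q∈S p≢q in NearAll⇒listed r∈S r≢H A≡

  center-sets : ∀ A → IsCenterSet A ⇔ Listed A
  center-sets A = mk⇔ (centerSet⇒listed {A}) (listed⇒centerSet {A})

mainTheorem7 : (n : ℕ) → 6 ≤ n → (A : Subset n) →
    Wheel.IsCenterSet n A ⇔ Wheel.Listed n A
-- Transporting along 6 + k ≡ n, rather than matching n against suc (… k), keeps Agda from
-- unfolding the center predicates to compare 6 + k with suc (… k).
mainTheorem7 n 6≤n =
  let k , 6+k≡n = m≤n⇒∃[o]m+o≡n 6≤n
  in subst (λ m → ∀ A → Wheel.IsCenterSet m A ⇔ Wheel.Listed m A) 6+k≡n (WheelCenters.center-sets k)
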